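{- Consider the following nine Boolean networks $(f_1,f_2)$ on two vertices: $[1,00]$: $f_1=0,f_2=0$; $[2,00]$: $f_1=0,f_2=x_1\land x_2$; $[3,00]$: $f_1=x_1\land x_2,f_2=0$; $[4,00]$: $f_1=0,f_2=x_1\land\neg x_2$; $[5,00]$: $f_1=0,f_2=x_1$; $[8,00]$: $f_1=x_1\land\neg x_2,f_2=x_1$; $[10,00]$: $f_1=\neg x_1\land x_2,f_2=0$; $[12,00]$: $f_1=x_2,f_2=0$; $[21,00]$: $f_1=x_2,f_2=\neg x_1\land x_2$. For any delay vector $dt=(\alpha,\beta)$, every MBN built on one of these networks has a unique attractor, the fixed point $(0,0)$.
   Context: The MBN built on a two-vertex Boolean network $(f_1,f_2)$ with delay vector $(\alpha,\beta)$ of positive integers has configurations $(\rho,\gamma)$ with $0\le\rho\le\alpha$, $0\le\gamma\le\beta$, underlying Boolean state $x=([\rho\ge1],[\gamma\ge1])$, and dynamics: the first coordinate becomes $\alpha$ if $f_1(x)=1$, else $\max(\rho-1,0)$; the second becomes $\beta$ if $f_2(x)=1$, else $\max(\gamma-1,0)$. Any configuration may be initial. Attractors are periodic orbits: fixed points (length 1) and limit cycles (length $\ge2$). -}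

module Defs where

open import Data.Bool using (Bool; true; false; _∧_; not; if_then_else_)
open import Data.Nat using (ℕ; zero; suc; _∸_; _≤_; _<_)
open import Data.Nat.Properties using (_≤?_)
open import Data.Product using (_×_; _,_; proj₁; proj₂; Σ; ∃)
open import Data.Fin using (Fin)
open import Data.List using (List; _∷_; [])
open import Relation.Nullary.Decidable using (⌊_⌋)
open import Relation.Binary.PropositionalEquality using (_≡_)
open import Function using (_∘_)

BN : Set
BN = (Bool → Bool → Bool) × (Bool → Bool → Bool)

Config : Set
Config = ℕ × ℕ

ValidConfig : ℕ → ℕ → Config → Set
ValidConfig α β (ρ , γ) = (ρ ≤ α) × (γ ≤ β)

pos : ℕ → Bool
pos zero = false
pos (suc _) = true

state : Config → Bool × Bool
state (ρ , γ) = pos ρ , pos γ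

-- MBN dynamics with delays (α , β); note max(ρ-1,0) = ρ ∸ 1 on ℕ
step : BN → ℕ → ℕ → Config → Config
step (f₁ , f₂) α β (ρ , γ) =
  (if f₁ (pos ρ) (pos γ) then α else ρ ∸ 1) ,
  (if f₂ (pos ρ) (pos γ) then β else γ ∸ 1)

iterate : (Config → Config) → ℕ → Config → Config
iterate F zero c = c
iterate F (suc k) c = F (iterate F k c)

-- c lies on a periodic orbit (i.e. belongs to some attractor: fixed point or limit cycle)
Periodic : BN → ℕ → ℕ → Config → Set
Periodic N α β c = ∃ λ k → (0 < k) × (iterate (step N α β) k c ≡ c)

IsFixedPoint : BN → ℕ → ℕ → Config → Set
IsFixedPoint N α β c = step N α β c ≡ c

UniqueAttractorZero : BN → ℕ → ℕ → Set
UniqueAttractorZero N α β =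
  IsFixedPoint N α β (0 , 0) ×
  (∀ c → ValidConfig α β c → Periodic N α β c → c ≡ (0 , 0))

net1 net2 net3 net4 net5 net8 net10 net12 net21 : BN
net1  = (λ x₁ x₂ → false)          , (λ x₁ x₂ → false)
net2  = (λ x₁ x₂ → false)          , (λ x₁ x₂ → x₁ ∧ x₂)
net3  = (λ x₁ x₂ → x₁ ∧ x₂)        , (λ x₁ x₂ → false)
net4  = (λ x₁ x₂ → false)          , (λ x₁ x₂ → x₁ ∧ not x₂)
net5  = (λ x₁ x₂ → false)          , (λ x₁ x₂ → x₁)
net8  = (λ x₁ x₂ → x₁ ∧ not x₂)    , (λ x₁ x₂ → x₁)
net10 = (λ x₁ x₂ → not x₁ ∧ x₂)    , (λ x₁ x₂ → false)
net12 = (λ x₁ x₂ → x₂)             , (λ x₁ x₂ → false)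
net21 = (λ x₁ x₂ → x₂)             , (λ x₁ x₂ → not x₁ ∧ x₂)

nineNetworks : List BN
nineNetworks = net1 ∷ net2 ∷ net3 ∷ net4 ∷ net5 ∷ net8 ∷ net10 ∷ net12 ∷ net21 ∷ []

{-# OPTIONS --safe #-}
-- A configuration that is periodic for a map admitting a ranking function which
-- strictly decreases everywhere except at a fixed point z must be z itself.
-- Four of the networks are feed-forward: vertex 1 never fires and vertex 2 fires
-- only while vertex 1 is on, so ρ runs down first and then γ. Network [8,00] is
-- handled by an explicit ranking, and the remaining four are mirror images of
-- these under exchanging the two vertices.
module Submission where

open import Defs
open import Data.Bool using (Bool; true; false; not; if_then_else_)
open import Data.Bool.Properties using (∧-comm)
open import Data.Nat using (ℕ; zero; suc; _+_; _≤_; _<_; s≤s; z≤n)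
open import Data.Nat.Properties
  using (≤-refl; ≤-trans; ≤-reflexive; <⇒≤; <⇒≱; ≤-<-trans; m∸n≤m; m<m+n; n<1+n; +-monoʳ-<; +-identityʳ; module ≤-Reasoning)
open import Data.Product using (_×_; _,_; proj₁; proj₂; swap)
open import Data.Sum using (_⊎_; inj₁; inj₂)
open import Data.List.Relation.Unary.All using (All; lookup; _∷_; [])
open import Data.List.Membership.Propositional using (_∈_)
open import Relation.Nullary using (contradiction)
open import Relation.Binary.PropositionalEquality using (_≡_; refl; sym; trans; cong; module ≡-Reasoning)

iterate-suc : ∀ (F : Config → Config) k c → iterate F (suc k) c ≡ iterate F k (F c)
iterate-suc F zero    c = refl
iterate-suc F (suc k) c = cong F (iterate-suc F k c)

module Ranking {F : Config → Config} {V : Config → Set} (F-preserves-V : ∀ {c} → V c → V (F c))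
               {rank : Config → ℕ} {z : Config} (F-z : F z ≡ z)
               (rank-decreasing : ∀ {c} → V c → c ≡ z ⊎ rank (F c) < rank c) where

  iterate-preserves-V : ∀ k {c} → V c → V (iterate F k c)
  iterate-preserves-V zero    v = v
  iterate-preserves-V (suc k) v = F-preserves-V (iterate-preserves-V k v)

  rank-F≤ : ∀ {c} → V c → rank (F c) ≤ rank c
  rank-F≤ v with rank-decreasing v
  ... | inj₁ refl = ≤-reflexive (cong rank F-z)
  ... | inj₂ lt   = <⇒≤ lt

  rank-iterate≤ : ∀ k {c} → V c → rank (iterate F k c) ≤ rank c
  rank-iterate≤ zero    v = ≤-refl
  rank-iterate≤ (suc k) v = ≤-trans (rank-F≤ (iterate-preserves-V k v)) (rank-iterate≤ k v)

  periodic⇒≡z : ∀ {c k} → V c → 0 < k → iterate F k c ≡ c → c ≡ z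
  periodic⇒≡z {c} {suc k} v _ cycle with rank-decreasing v
  ... | inj₁ c≡z = c≡z
  ... | inj₂ lt  = contradiction rank-c≤rank-Fc (<⇒≱ lt)
    where
    open ≤-Reasoning
    rank-c≤rank-Fc : rank c ≤ rank (F c)
    rank-c≤rank-Fc = begin
      rank c                        ≡⟨ cong rank (sym cycle) ⟩
      rank (iterate F (suc k) c)    ≡⟨ cong rank (iterate-suc F k c) ⟩
      rank (iterate F k (F c))      ≤⟨ rank-iterate≤ k (F-preserves-V v) ⟩
      rank (F c)                    ∎

if-≤ : ∀ b {m n} → n ≤ m → (if b then m else n) ≤ m
if-≤ true  _   = ≤-refl
if-≤ false n≤m = n≤m

step-valid : ∀ N {α β c} → ValidConfig α β c → ValidConfig α β (step N α β c)
step-valid (f₁ , f₂) {c = ρ , γ} (ρ≤α , γ≤β) =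
  if-≤ (f₁ (pos ρ) (pos γ)) (≤-trans (m∸n≤m ρ 1) ρ≤α) ,
  if-≤ (f₂ (pos ρ) (pos γ)) (≤-trans (m∸n≤m γ 1) γ≤β)

uniqueAttractorZero-ranked : ∀ N α β (rank : Config → ℕ) → IsFixedPoint N α β (0 , 0)
  → (∀ {c} → ValidConfig α β c → c ≡ (0 , 0) ⊎ rank (step N α β c) < rank c)
  → UniqueAttractorZero N α β
uniqueAttractorZero-ranked N α β rank fixed decreasing =
  fixed , λ c v (k , k>0 , cycle) → periodic⇒≡z v k>0 cycle
  where open Ranking (step-valid N) fixed decreasing

-- While vertex 1 is on, γ may be refreshed up to β, so ρ is weighted above every γ.
rankFeedForward : ℕ → Config → ℕ
rankFeedForward β (zero  , γ) = γ
rankFeedForward β (suc ρ , γ) = β + suc ρ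

rankFeedForward-< : ∀ {β γ} ρ → γ ≤ β → rankFeedForward β (ρ , γ) < β + suc ρ
rankFeedForward-< {β} zero    γ≤β = ≤-<-trans γ≤β (m<m+n β (s≤s z≤n))
rankFeedForward-< {β} (suc ρ) _   = +-monoʳ-< β (n<1+n (suc ρ))

FeedForward : BN → Set
FeedForward (f₁ , f₂) = (∀ x y → f₁ x y ≡ false) × (∀ y → f₂ false y ≡ false)

uniqueAttractorZero-feedForward : ∀ N → FeedForward N → ∀ α β → UniqueAttractorZero N α β
uniqueAttractorZero-feedForward (f₁ , f₂) (f₁-off , f₂-off) α β =
  uniqueAttractorZero-ranked (f₁ , f₂) α β (rankFeedForward β) fixed decreasing
  where
  fixed : IsFixedPoint (f₁ , f₂) α β (0 , 0)
  fixed rewrite f₁-off false false | f₂-off false = refl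

  decreasing : ∀ {c} → ValidConfig α β c
    → c ≡ (0 , 0) ⊎ rankFeedForward β (step (f₁ , f₂) α β c) < rankFeedForward β c
  decreasing {zero  , zero}  _ = inj₁ refl
  decreasing {zero  , suc γ} _ rewrite f₁-off false true | f₂-off true = inj₂ (n<1+n γ)
  decreasing {suc ρ , γ}     v rewrite f₁-off true (pos γ) =
    inj₂ (rankFeedForward-< ρ (proj₂ (step-valid (f₁ , f₂) v)))

-- From (ρ > 0 , 0) both vertices fire and jump to (α , β); every other move lowers ρ or γ.
rankNet8 : ℕ → ℕ → Config → ℕ
rankNet8 α β (zero  , γ)     = γ
rankNet8 α β (suc ρ , zero)  = suc (β + α)
rankNet8 α β (suc ρ , suc γ) = β + suc ρ

rankNet8-refreshed : ∀ {α} b ρ → rankNet8 α (suc b) (ρ , suc b) ≤ suc b + ρ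
rankNet8-refreshed b zero    = ≤-reflexive (sym (+-identityʳ (suc b)))
rankNet8-refreshed b (suc ρ) = ≤-refl

uniqueAttractorZero-net8 : ∀ α β → 0 < β → UniqueAttractorZero net8 α β
uniqueAttractorZero-net8 α (suc b) _ =
  uniqueAttractorZero-ranked net8 α (suc b) (rankNet8 α (suc b)) refl decreasing
  where
  decreasing : ∀ {c} → ValidConfig α (suc b) c
    → c ≡ (0 , 0) ⊎ rankNet8 α (suc b) (step net8 α (suc b) c) < rankNet8 α (suc b) c
  decreasing {zero  , zero}  _ = inj₁ refl
  decreasing {zero  , suc γ} _ = inj₂ (n<1+n γ)
  decreasing {suc ρ , zero}  _ = inj₂ (s≤s (rankNet8-refreshed b α))
  decreasing {suc ρ , suc γ} _ = inj₂ (≤-<-trans (rankNet8-refreshed b ρ) (+-monoʳ-< (suc b) (n<1+n ρ)))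

_IsMirrorOf_ : BN → BN → Set
M IsMirrorOf N = ∀ x y → (proj₁ M x y ≡ proj₂ N y x) × (proj₂ M x y ≡ proj₁ N y x)

step-mirror : ∀ {M N} → M IsMirrorOf N → ∀ α β c → step M α β (swap c) ≡ swap (step N β α c)
step-mirror {f₁ , f₂} {g₁ , g₂} mirror α β (ρ , γ)
  rewrite proj₁ (mirror (pos γ) (pos ρ)) | proj₂ (mirror (pos γ) (pos ρ)) = refl

iterate-mirror : ∀ {M N} → M IsMirrorOf N → ∀ α β k c
  → iterate (step M α β) k (swap c) ≡ swap (iterate (step N β α) k c)
iterate-mirror mirror α β zero    c = refl
iterate-mirror {M} {N} mirror α β (suc k) c = begin
  step M α β (iterate (step M α β) k (swap c))    ≡⟨ cong (step M α β) (iterate-mirror mirror α β k c) ⟩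
  step M α β (swap (iterate (step N β α) k c))    ≡⟨ step-mirror mirror α β _ ⟩
  swap (step N β α (iterate (step N β α) k c))    ∎
  where open ≡-Reasoning

uniqueAttractorZero-mirror : ∀ {M N} → M IsMirrorOf N → ∀ {α β}
  → UniqueAttractorZero N β α → UniqueAttractorZero M α β
uniqueAttractorZero-mirror mirror {α} {β} (fixed , onlyZero) =
  trans (step-mirror mirror α β (0 , 0)) (cong swap fixed) ,
  λ { (ρ , γ) (ρ≤α , γ≤β) (k , k>0 , cycle) →
      cong swap (onlyZero (γ , ρ) (γ≤β , ρ≤α)
        (k , k>0 , cong swap (trans (sym (iterate-mirror mirror α β k (γ , ρ))) cycle))) }

net1-feedForward : FeedForward net1
net1-feedForward = (λ _ _ → refl) , (λ _ → refl)

net2-feedForward : FeedForward net2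
net2-feedForward = (λ _ _ → refl) , (λ _ → refl)

net4-feedForward : FeedForward net4
net4-feedForward = (λ _ _ → refl) , (λ _ → refl)

net5-feedForward : FeedForward net5
net5-feedForward = (λ _ _ → refl) , (λ _ → refl)

net3-mirrors-net2 : net3 IsMirrorOf net2
net3-mirrors-net2 x y = ∧-comm x y , refl

net10-mirrors-net4 : net10 IsMirrorOf net4
net10-mirrors-net4 x y = ∧-comm (not x) y , refl

net12-mirrors-net5 : net12 IsMirrorOf net5
net12-mirrors-net5 x y = refl , refl

net21-mirrors-net8 : net21 IsMirrorOf net8
net21-mirrors-net8 x y = refl , ∧-comm (not x) y

HasUniqueAttractorZero : BN → Set
HasUniqueAttractorZero N = ∀ α β → 0 < α → 0 < β → UniqueAttractorZero N α β

proposition4 : ∀ (N : BN) → N ∈ nineNetworks → ∀ (α β : ℕ) → 0 < α → 0 < β → UniqueAttractorZero N α β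
proposition4 N = lookup nineNetworks-haveUniqueAttractorZero
  where
  feedForward : ∀ N → FeedForward N → HasUniqueAttractorZero N
  feedForward N ff α β _ _ = uniqueAttractorZero-feedForward N ff α β

  mirrorOf : ∀ {M N} → M IsMirrorOf N → HasUniqueAttractorZero N → HasUniqueAttractorZero M
  mirrorOf mirror hasN α β α>0 β>0 = uniqueAttractorZero-mirror mirror (hasN β α β>0 α>0)

  net8-has : HasUniqueAttractorZero net8
  net8-has α β _ β>0 = uniqueAttractorZero-net8 α β β>0

  nineNetworks-haveUniqueAttractorZero : All HasUniqueAttractorZero nineNetworks
  nineNetworks-haveUniqueAttractorZero =
    feedForward net1 net1-feedForward ∷
    feedForward net2 net2-feedForward ∷
    mirrorOf net3-mirrors-net2 (feedForward net2 net2-feedForward) ∷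
    feedForward net4 net4-feedForward ∷
    feedForward net5 net5-feedForward ∷
    net8-has ∷
    mirrorOf net10-mirrors-net4 (feedForward net4 net4-feedForward) ∷
    mirrorOf net12-mirrors-net5 (feedForward net5 net5-feedForward) ∷
    mirrorOf net21-mirrors-net8 net8-has ∷
    []
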